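{- (1) $\to_{\beta_i}$ is strongly normalizing and strongly confluent. (2) $\to_{\beta_\lambda}$ and $\to_{\beta_i}$ strongly commute. (3) $\to_{\beta_f}$ is strongly confluent, and all $\beta_f$-normalizing derivations $d$ from a given $\lambda$-term $t$ (if any) have the same length $|d|$, the same number $|d|_{\beta_\lambda}$ of $\beta_\lambda$-steps, and the same number $|d|_{\beta_i}$ of $\beta_i$-steps.
   Context: $\lambda$-terms: $t,u::= v\mid tu$, values $v::= x\mid \lambda x.t$, up to $\alpha$; $t\{x\leftarrow u\}$ capture-avoiding substitution. Evaluation contexts $E::=\langle\cdot\rangle\mid tE\mid Et$. Fireballs $f::=\lambda x.t\mid i$ and inert terms $i::= x f_1\dots f_n$ ($n\ge0$). $\to_{\beta_\lambda}$ and $\to_{\beta_i}$ are the closures under evaluation contexts of $(\lambda x.t)(\lambda y.u)\mapsto t\{x\leftarrow \lambda y.u\}$ and $(\lambda x.t)i\mapsto t\{x\leftarrow i\}$ ($i$ inert); $\to_{\beta_f}=\to_{\beta_\lambda}\cup\to_{\beta_i}$. A relation $\to$ is strongly normalizing if there is no infinite $\to$-sequence; strongly confluent if whenever $s\leftarrow t\to u$ with $u\ne s$ there is $r$ with $u\to r\leftarrow s$. Relations $\to_1,\to_2$ strongly commute if whenever $u\leftarrow_1 t\to_2 s$, then $u\ne s$ and there is $r$ with $u\to_2 r\leftarrow_1 s$. A normalizing derivation ends in a normal form. -}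

module Defs where

open import Data.Nat using (ℕ; zero; suc; _+_)
open import Data.Product using (Σ; ∃; _×_; _,_)
open import Data.Sum using (_⊎_; inj₁; inj₂)
open import Data.Empty using (⊥)
open import Relation.Nullary using (¬_)
open import Relation.Binary.PropositionalEquality using (_≡_; _≢_)

-- λ-terms up to α-equivalence, as de Bruijn terms.
data Term : Set where
  var : ℕ → Term
  lam : Term → Term
  app : Term → Term → Term

ext : (ℕ → ℕ) → ℕ → ℕ
ext ρ zero    = zero
ext ρ (suc n) = suc (ρ n)

rename : (ℕ → ℕ) → Term → Term
rename ρ (var x)   = var (ρ x)
rename ρ (lam t)   = lam (rename (ext ρ) t)
rename ρ (app t u) = app (rename ρ t) (rename ρ u)

exts : (ℕ → Term) → ℕ → Term
exts σ zero    = var zero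
exts σ (suc n) = rename suc (σ n)

sub : (ℕ → Term) → Term → Term
sub σ (var x)   = σ x
sub σ (lam t)   = lam (sub (exts σ) t)
sub σ (app t u) = app (sub σ t) (sub σ u)

σ₀ : Term → ℕ → Term
σ₀ u zero    = u
σ₀ u (suc n) = var n

-- t [ u ]  is  t{x←u}  where x is the variable bound by the enclosing λ (index 0).
_[_] : Term → Term → Term
t [ u ] = sub (σ₀ u) t

mutual
  data Inert : Term → Set where
    ivar : ∀ x → Inert (var x)
    iapp : ∀ {i f} → Inert i → Fireball f → Inert (app i f)

  data Fireball : Term → Set where
    flam : ∀ t → Fireball (lam t)
    finert : ∀ {i} → Inert i → Fireball i

data _→βλ_ : Term → Term → Set where
  root : ∀ t u → app (lam t) (lam u) →βλ (t [ lam u ])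
  appL : ∀ {t t'} u → t →βλ t' → app t u →βλ app t' u
  appR : ∀ t {u u'} → u →βλ u' → app t u →βλ app t u'

data _→βi_ : Term → Term → Set where
  root : ∀ t {i} → Inert i → app (lam t) i →βi (t [ i ])
  appL : ∀ {t t'} u → t →βi t' → app t u →βi app t' u
  appR : ∀ t {u u'} → u →βi u' → app t u →βi app t u'

_→βf_ : Term → Term → Set
t →βf u = (t →βλ u) ⊎ (t →βi u)

Rel : Set₁
Rel = Term → Term → Set

StronglyNormalizing : Rel → Set
StronglyNormalizing R = ¬ (Σ (ℕ → Term) λ f → ∀ n → R (f n) (f (suc n)))

StronglyConfluent : Rel → Set
StronglyConfluent R = ∀ {t s u} → R t s → R t u → u ≢ s → ∃ λ r → R u r × R s r

StronglyCommute : Rel → Rel → Set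
StronglyCommute R₁ R₂ = ∀ {t u s} → R₁ t u → R₂ t s → (u ≢ s) × (∃ λ r → R₂ u r × R₁ s r)

NormalForm : Rel → Term → Set
NormalForm R t = ¬ (∃ λ u → R t u)

data Deriv : Term → Term → Set where
  done : ∀ {t} → Deriv t t
  step : ∀ {t u s} → t →βf u → Deriv u s → Deriv t s

∣_∣ : ∀ {t s} → Deriv t s → ℕ
∣ done ∣     = 0
∣ step _ d ∣ = suc ∣ d ∣

∣_∣λ : ∀ {t s} → Deriv t s → ℕ
∣ done ∣λ            = 0
∣ step (inj₁ _) d ∣λ = suc ∣ d ∣λ
∣ step (inj₂ _) d ∣λ = ∣ d ∣λ

∣_∣i : ∀ {t s} → Deriv t s → ℕ
∣ done ∣i            = 0
∣ step (inj₁ _) d ∣i = ∣ d ∣i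
∣ step (inj₂ _) d ∣i = suc ∣ d ∣i

module Submission where

-- (1) Strong normalisation of β_i: the `weight` of a term counts its
--     λ-abstractions, ignoring abstractions in argument position together with
--     their bodies.  Inert terms have weight 0, so substituting inert terms
--     preserves weight, and every β_i step strictly decreases it.
-- (2) Local diagrams: fireballs are β_f-normal, hence root redexes do not
--     overlap with steps inside their subterms.  Consequently β_λ and β_i each
--     have the one-step diamond property (`Diamond`: two steps from a term
--     coincide or close in one step each), and β_λ, β_i strongly commute;
--     distinctness of the two results uses irreflexivity of β_i from (1).
-- (3) The diamond property of β_f follows; it yields strong confluence and the
--     "random descent" argument: any normalising derivation can be rearranged
--     to start with any given first step without changing its numbers of
--     β_λ- and β_i-steps (`resume`).  Induction on the second derivation then
--     shows that normalising derivations agree in both counts, hence in length.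

open import Defs
open import Data.Nat using (ℕ; zero; suc; _+_; _≤_; _<_; z≤n; s≤s)
open import Data.Nat.Properties
  using (≤-refl; ≤-trans; <-irrefl; m≤m+n; +-monoˡ-<; +-monoʳ-<; +-suc)
open import Data.Nat.Induction using (<-wellFounded)
open import Induction.WellFounded using (Acc; acc)
open import Data.Product using (Σ; ∃; _×_; _,_; proj₂)
open import Data.Sum using (_⊎_; inj₁; inj₂)
open import Data.Empty using (⊥; ⊥-elim)
open import Relation.Binary.PropositionalEquality
  using (_≡_; _≢_; refl; sym; trans; cong; cong₂)

measure⇒SN : ∀ {R : Rel} (μ : Term → ℕ) →
             (∀ {t u} → R t u → μ u < μ t) → StronglyNormalizing R
measure⇒SN {R} μ decreases (f , chain) = noChainFrom 0 (<-wellFounded (μ (f 0)))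
  where
  noChainFrom : ∀ n → Acc _<_ (μ (f n)) → ⊥
  noChainFrom n (acc smaller) =
    noChainFrom (suc n) (smaller (decreases {f n} {f (suc n)} (chain n)))

Diamond : Rel → Set
Diamond R = ∀ {t s u} → R t s → R t u → s ≡ u ⊎ ∃ λ r → R s r × R u r

diamond⇒strongly-confluent : ∀ {R : Rel} → Diamond R → StronglyConfluent R
diamond⇒strongly-confluent diamond ts tu u≢s with diamond ts tu
... | inj₁ s≡u              = ⊥-elim (u≢s (sym s≡u))
... | inj₂ (r , sr , ur)    = r , ur , sr

mutual
  rename-inert : ∀ ρ {i} → Inert i → Inert (rename ρ i)
  rename-inert ρ (ivar x)   = ivar (ρ x)
  rename-inert ρ (iapp i f) = iapp (rename-inert ρ i) (rename-fireball ρ f)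

  rename-fireball : ∀ ρ {f} → Fireball f → Fireball (rename ρ f)
  rename-fireball ρ (flam t)   = flam _
  rename-fireball ρ (finert i) = finert (rename-inert ρ i)

-- Fireballs are β_f-normal: every redex of λx.t or x f₁…fₙ would have to sit
-- inside an argument fᵢ, or have an abstraction as head of x f₁…fₖ.
mutual
  inert-normal : ∀ {i} → Inert i → NormalForm _→βf_ i
  inert-normal (ivar x)   (_ , inj₁ ())
  inert-normal (ivar x)   (_ , inj₂ ())
  inert-normal (iapp () f) (_ , inj₁ (root _ _))
  inert-normal (iapp () f) (_ , inj₂ (root _ _))
  inert-normal (iapp i f) (_ , inj₁ (appL _ s)) = inert-normal i (_ , inj₁ s)
  inert-normal (iapp i f) (_ , inj₂ (appL _ s)) = inert-normal i (_ , inj₂ s)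
  inert-normal (iapp i f) (_ , inj₁ (appR _ s)) = fireball-normal f (_ , inj₁ s)
  inert-normal (iapp i f) (_ , inj₂ (appR _ s)) = fireball-normal f (_ , inj₂ s)

  fireball-normal : ∀ {f} → Fireball f → NormalForm _→βf_ f
  fireball-normal (flam t)   (_ , inj₁ ())
  fireball-normal (flam t)   (_ , inj₂ ())
  fireball-normal (finert i) s = inert-normal i s

mutual
  weight : Term → ℕ
  weight (var x)   = 0
  weight (lam t)   = suc (weight t)
  weight (app t u) = weight t + argWeight u

  argWeight : Term → ℕ
  argWeight (var x)   = 0
  argWeight (lam t)   = 0
  argWeight (app t u) = weight t + argWeight u

argWeight≤weight : ∀ t → argWeight t ≤ weight t
argWeight≤weight (var x)   = z≤n
argWeight≤weight (lam t)   = z≤n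
argWeight≤weight (app t u) = ≤-refl

mutual
  inert-weight : ∀ {i} → Inert i → weight i ≡ 0
  inert-weight (ivar x)   = refl
  inert-weight (iapp i f) = cong₂ _+_ (inert-weight i) (fireball-argWeight f)

  fireball-argWeight : ∀ {f} → Fireball f → argWeight f ≡ 0
  fireball-argWeight (flam t)              = refl
  fireball-argWeight (finert (ivar x))     = refl
  fireball-argWeight (finert (iapp i f))   = inert-weight (iapp i f)

InertSubst : (ℕ → Term) → Set
InertSubst σ = ∀ n → Inert (σ n)

exts-inert : ∀ {σ} → InertSubst σ → InertSubst (exts σ)
exts-inert σ-inert zero    = ivar zero
exts-inert σ-inert (suc n) = rename-inert suc (σ-inert n)

σ₀-inert : ∀ {i} → Inert i → InertSubst (σ₀ i)
σ₀-inert i-inert zero    = i-inert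
σ₀-inert i-inert (suc n) = ivar n

mutual
  sub-weight : ∀ {σ} → InertSubst σ → ∀ t → weight (sub σ t) ≡ weight t
  sub-weight σ-inert (var x)   = inert-weight (σ-inert x)
  sub-weight σ-inert (lam t)   = cong suc (sub-weight (exts-inert σ-inert) t)
  sub-weight σ-inert (app t u) = cong₂ _+_ (sub-weight σ-inert t) (sub-argWeight σ-inert u)

  sub-argWeight : ∀ {σ} → InertSubst σ → ∀ t → argWeight (sub σ t) ≡ argWeight t
  sub-argWeight σ-inert (var x)   = fireball-argWeight (finert (σ-inert x))
  sub-argWeight σ-inert (lam t)   = refl
  sub-argWeight σ-inert (app t u) = cong₂ _+_ (sub-weight σ-inert t) (sub-argWeight σ-inert u)

-- A β_i step erases one counted λ and substitutes an inert term.
mutual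
  βi-weight : ∀ {t u} → t →βi u → weight u < weight t
  βi-weight (root t {i} i-inert) rewrite sub-weight (σ₀-inert i-inert) t =
    s≤s (m≤m+n (weight t) (argWeight i))
  βi-weight (appL u s)         = +-monoˡ-< (argWeight u) (βi-weight s)
  βi-weight (appR t s)         = +-monoʳ-< (weight t) (βi-argWeight s)

  -- a term that β_i-steps is an application, so its argWeight is its weight
  βi-argWeight : ∀ {t u} → t →βi u → argWeight u < argWeight t
  βi-argWeight {u = u} s@(root _ _) = ≤-trans (s≤s (argWeight≤weight u)) (βi-weight s)
  βi-argWeight {u = u} s@(appL _ _) = ≤-trans (s≤s (argWeight≤weight u)) (βi-weight s)
  βi-argWeight {u = u} s@(appR _ _) = ≤-trans (s≤s (argWeight≤weight u)) (βi-weight s)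

βi-SN : StronglyNormalizing _→βi_
βi-SN = measure⇒SN {_→βi_} weight βi-weight

βi-irreflexive : ∀ {t u} → t →βi u → t ≢ u
βi-irreflexive s refl = <-irrefl refl (βi-weight s)

app-injˡ : ∀ {t t' u u'} → app t u ≡ app t' u' → t ≡ t'
app-injˡ refl = refl

app-injʳ : ∀ {t t' u u'} → app t u ≡ app t' u' → u ≡ u'
app-injʳ refl = refl

-- β_λ: two root steps coincide, a root redex has no inner β_λ-redex (its
-- components are abstractions), and steps in disjoint subterms commute.
βλ-diamond : Diamond _→βλ_
βλ-diamond (root t u)  (root .t .u) = inj₁ refl
βλ-diamond (root t u)  (appL _ ())
βλ-diamond (root t u)  (appR _ ())
βλ-diamond (appL u ()) (root _ _)
βλ-diamond (appR t ()) (root _ _)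
βλ-diamond (appL u s)  (appR t s')  = inj₂ (_ , appR _ s' , appL _ s)
βλ-diamond (appR t s)  (appL u s')  = inj₂ (_ , appL _ s' , appR _ s)
βλ-diamond (appL u s)  (appL .u s') with βλ-diamond s s'
... | inj₁ refl          = inj₁ refl
... | inj₂ (r , p , q)   = inj₂ (app r u , appL u p , appL u q)
βλ-diamond (appR t s)  (appR .t s') with βλ-diamond s s'
... | inj₁ refl          = inj₁ refl
... | inj₂ (r , p , q)   = inj₂ (app t r , appR t p , appR t q)

-- β_i: as for β_λ; the argument of a β_i root redex is inert, hence normal.
βi-diamond : Diamond _→βi_
βi-diamond (root t _)   (root .t _)  = inj₁ refl
βi-diamond (root t _)   (appL _ ())
βi-diamond (root t i)   (appR _ s')  = ⊥-elim (inert-normal i (_ , inj₂ s'))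
βi-diamond (appL u ())  (root _ _)
βi-diamond (appR t s)   (root _ i)   = ⊥-elim (inert-normal i (_ , inj₂ s))
βi-diamond (appL u s)   (appR t s')  = inj₂ (_ , appR _ s' , appL _ s)
βi-diamond (appR t s)   (appL u s')  = inj₂ (_ , appL _ s' , appR _ s)
βi-diamond (appL u s)   (appL .u s') with βi-diamond s s'
... | inj₁ refl          = inj₁ refl
... | inj₂ (r , p , q)   = inj₂ (app r u , appL u p , appL u q)
βi-diamond (appR t s)   (appR .t s') with βi-diamond s s'
... | inj₁ refl          = inj₁ refl
... | inj₂ (r , p , q)   = inj₂ (app t r , appR t p , appR t q)

-- β_λ and β_i never share a root redex (an abstraction is not inert), and steps
-- in disjoint subterms commute; the results differ since β_i is irreflexive.
βλ-βi-commute : StronglyCommute _→βλ_ _→βi_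
βλ-βi-commute (root t u) (root .t ())
βλ-βi-commute (root t u) (appL _ ())
βλ-βi-commute (root t u) (appR _ ())
βλ-βi-commute (appL u ()) (root _ _)
βλ-βi-commute (appR t s) (root _ i) = ⊥-elim (inert-normal i (_ , inj₁ s))
βλ-βi-commute (appL u s) (appR t s') =
  (λ e → βi-irreflexive s' (app-injʳ e)) , _ , appR _ s' , appL _ s
βλ-βi-commute (appR t s) (appL u s') =
  (λ e → βi-irreflexive s' (app-injˡ e)) , _ , appL _ s' , appR _ s
βλ-βi-commute (appL u s) (appL .u s') with βλ-βi-commute s s'
... | u≢s , r , p , q = (λ e → u≢s (app-injˡ e)) , app r u , appL u p , appL u q
βλ-βi-commute (appR t s) (appR .t s') with βλ-βi-commute s s'
... | u≢s , r , p , q = (λ e → u≢s (app-injʳ e)) , app t r , appR t p , appR t q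

βf-diamond : Diamond _→βf_
βf-diamond (inj₁ s) (inj₁ s') with βλ-diamond s s'
... | inj₁ eq            = inj₁ eq
... | inj₂ (r , p , q)   = inj₂ (r , inj₁ p , inj₁ q)
βf-diamond (inj₂ s) (inj₂ s') with βi-diamond s s'
... | inj₁ eq            = inj₁ eq
... | inj₂ (r , p , q)   = inj₂ (r , inj₂ p , inj₂ q)
βf-diamond (inj₁ s) (inj₂ s') with proj₂ (βλ-βi-commute s s')
... | r , p , q          = inj₂ (r , inj₂ p , inj₁ q)
βf-diamond (inj₂ s) (inj₁ s') with proj₂ (βλ-βi-commute s' s)
... | r , p , q          = inj₂ (r , inj₁ q , inj₂ p)

_≈_ : ∀ {t s t' s'} → Deriv t s → Deriv t' s' → Set
d ≈ e = (∣ d ∣λ ≡ ∣ e ∣λ) × (∣ d ∣i ≡ ∣ e ∣i)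

≈-trans : ∀ {t s t' s' t'' s''} {d : Deriv t s} {e : Deriv t' s'} {g : Deriv t'' s''} →
          d ≈ e → e ≈ g → d ≈ g
≈-trans (pλ , pi) (qλ , qi) = trans pλ qλ , trans pi qi

≈-step : ∀ {t u s s'} (b : t →βf u) {d : Deriv u s} {e : Deriv u s'} →
         d ≈ e → step b d ≈ step b e
≈-step (inj₁ _) (pλ , pi) = cong suc pλ , pi
≈-step (inj₂ _) (pλ , pi) = pλ , cong suc pi

length-split : ∀ {t s} (d : Deriv t s) → ∣ d ∣ ≡ ∣ d ∣λ + ∣ d ∣i
length-split done             = refl
length-split (step (inj₁ _) d) = cong suc (length-split d)
length-split (step (inj₂ _) d) = trans (cong suc (length-split d)) (sym (+-suc ∣ d ∣λ ∣ d ∣i))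

-- A derivation to a normal form can be made to start with any given step b,
-- keeping its step counts: close the first step of d and b by the diamond
-- and continue from the joining term.
resume : ∀ {t s u} (d : Deriv t s) → NormalForm _→βf_ s → (b : t →βf u) →
         Σ (Deriv u s) λ d' → d ≈ step b d'
resume done nf b = ⊥-elim (nf (_ , b))
resume (step (inj₁ a) d) nf (inj₁ b) with βλ-diamond a b
... | inj₁ refl = d , refl , refl
... | inj₂ (r , a' , b') with resume d nf (inj₁ a')
...   | d' , d≈ = step (inj₁ b') d' , ≈-step (inj₁ a) {d} {step (inj₁ a') d'} d≈
resume (step (inj₂ a) d) nf (inj₂ b) with βi-diamond a b
... | inj₁ refl = d , refl , refl
... | inj₂ (r , a' , b') with resume d nf (inj₂ a')
...   | d' , d≈ = step (inj₂ b') d' , ≈-step (inj₂ a) {d} {step (inj₂ a') d'} d≈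
resume (step (inj₁ a) d) nf (inj₂ b) with proj₂ (βλ-βi-commute a b)
... | r , a' , b' with resume d nf (inj₂ a')
...   | d' , d≈ = step (inj₁ b') d' , ≈-step (inj₁ a) {d} {step (inj₂ a') d'} d≈
resume (step (inj₂ a) d) nf (inj₁ b) with proj₂ (βλ-βi-commute b a)
... | r , b' , a' with resume d nf (inj₁ a')
...   | d' , d≈ = step (inj₂ b') d' , ≈-step (inj₂ a) {d} {step (inj₁ a') d'} d≈

-- Any two normalising derivations from the same term have equal step counts:
-- rearrange d to start with the first step of e and proceed by induction on e.
normalising-same-counts : ∀ {t s s'} (d : Deriv t s) (e : Deriv t s') →
                          NormalForm _→βf_ s → NormalForm _→βf_ s' → d ≈ e
normalising-same-counts done       done       nf nf' = refl , refl
normalising-same-counts (step a d) done       nf nf' = ⊥-elim (nf' (_ , a))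
normalising-same-counts d          (step b e) nf nf' with resume d nf b
... | d' , d≈ = ≈-trans {d = d} {step b d'} {step b e} d≈
                  (≈-step b {d'} {e} (normalising-same-counts d' e nf nf'))


proposition3 : (StronglyNormalizing _→βi_ × StronglyConfluent _→βi_)
    × StronglyCommute _→βλ_ _→βi_
    × (StronglyConfluent _→βf_
    × (∀ {t s s'} (d : Deriv t s) (e : Deriv t s') →
    NormalForm _→βf_ s → NormalForm _→βf_ s' →
    (∣ d ∣ ≡ ∣ e ∣) × (∣ d ∣λ ≡ ∣ e ∣λ) × (∣ d ∣i ≡ ∣ e ∣i)))
proposition3 =
    (βi-SN , diamond⇒strongly-confluent βi-diamond)
  , βλ-βi-commute
  , diamond⇒strongly-confluent βf-diamond
  , same-counts
  where
  same-counts : ∀ {t s s'} (d : Deriv t s) (e : Deriv t s') →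
                NormalForm _→βf_ s → NormalForm _→βf_ s' →
                (∣ d ∣ ≡ ∣ e ∣) × (∣ d ∣λ ≡ ∣ e ∣λ) × (∣ d ∣i ≡ ∣ e ∣i)
  same-counts d e nf nf' with normalising-same-counts d e nf nf'
  ... | sameλ , samei =
    trans (length-split d) (trans (cong₂ _+_ sameλ samei) (sym (length-split e)))
    , sameλ , samei
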